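{- Every vertex $v\in N(C)$ either has at most $3$ neighbors in $C$, which are consecutive on $C$, or is adjacent to every vertex of $C$.
   Context: Graphs are finite and simple. A hole is an induced cycle of length at least $4$; a graph is chordal if it has no hole. Let $s_k=4k(\log k+\log\log k+4)$ for $k\ge2$, $s_1=2$, and $\mu_k=76s_{k+1}+3217k+1985$. Standing assumptions: $G$ is a graph, $k$ a positive integer, $C$ a shortest hole of $G$ of length strictly greater than $\mu_k$, and $G-V(C)$ is chordal. $N(C)$ is the set of vertices outside $V(C)$ with a neighbor in $V(C)$. -}

module Defs where

open import Data.Nat using (ℕ; zero; suc; _+_; _*_; _∸_; _^_; _≤_; _<_)
open import Data.Fin using (Fin; toℕ)
open import Data.Product using (_×_; ∃-syntax)
open import Data.Sum using (_⊎_)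
open import Relation.Binary.PropositionalEquality using (_≡_; _≢_)
open import Relation.Nullary using (¬_; Dec)
open import Function.Definitions using (Injective)
open import Function.Bundles using (_⇔_)

record Graph : Set₁ where
  field
    n       : ℕ
    _~_     : Fin n → Fin n → Set
    ~-dec   : ∀ u v → Dec (u ~ v)
    ~-sym   : ∀ {u v} → u ~ v → v ~ u
    ~-irrefl : ∀ {u} → ¬ (u ~ u)

open Graph public

Succ : (ℓ : ℕ) → Fin ℓ → Fin ℓ → Set
Succ ℓ i j = (suc (toℕ i) ≡ toℕ j) ⊎ (suc (toℕ i) ≡ ℓ × toℕ j ≡ 0)

CycAdj : (ℓ : ℕ) → Fin ℓ → Fin ℓ → Set
CycAdj ℓ i j = Succ ℓ i j ⊎ Succ ℓ j i

IsHole : (G : Graph) (ℓ : ℕ) → (Fin ℓ → Fin (n G)) → Set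
IsHole G ℓ c = (4 ≤ ℓ) × Injective _≡_ _≡_ c × (∀ i j → (_~_ G (c i) (c j)) ⇔ CycAdj ℓ i j)

IsShortestHole : (G : Graph) (ℓ : ℕ) → (Fin ℓ → Fin (n G)) → Set
IsShortestHole G ℓ c = IsHole G ℓ c × (∀ ℓ' (d : Fin ℓ' → Fin (n G)) → IsHole G ℓ' d → ℓ ≤ ℓ')

InCycle : (G : Graph) {ℓ : ℕ} → (Fin ℓ → Fin (n G)) → Fin (n G) → Set
InCycle G c v = ∃[ i ] c i ≡ v

-- G - V(C) is chordal: no hole of G - V(C). Holes of the induced subgraph G - V(C)
-- are exactly the holes of G all of whose vertices lie outside V(C).
ChordalMinus : (G : Graph) {ℓ : ℕ} → (Fin ℓ → Fin (n G)) → Set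
ChordalMinus G c = ∀ ℓ' (d : Fin ℓ' → Fin (n G)) → IsHole G ℓ' d → ¬ (∀ i → ¬ InCycle G c (d i))

InNbhd : (G : Graph) {ℓ : ℕ} → (Fin ℓ → Fin (n G)) → Fin (n G) → Set
InNbhd G c v = ¬ InCycle G c v × ∃[ i ] _~_ G v (c i)

-- μ_k < L, where μ_k = 76 s_{k+1} + 3217k + 1985 and s_m = 4m(log m + log log m + 4)
-- (m = k+1 ≥ 2, log = log₂), encoded exactly in ℕ:
--   with m = k+1, B = 3217k + 1985 + 1216m, p = L - B,
--   μ_k < L  iff  B ≤ L and there are u, w (w ≥ 1) with
--     (u/w)^(304m) < 2^p   (i.e. u/w < 2^(p/(304m)))   and
--     m^(w m) < 2^u        (i.e. m log₂ m < u/w).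
MuLt : ℕ → ℕ → Set
MuLt k L =
  (B ≤ L) × ∃[ u ] ∃[ w ] ((1 ≤ w) × (u ^ (304 * m) < 2 ^ (L ∸ B) * w ^ (304 * m)) × (m ^ (w * m) < 2 ^ u))
  where
    m = suc k
    B = 3217 * k + 1985 + 1216 * m

InWindow : (ℓ : ℕ) → Fin ℓ → ℕ → Fin ℓ → Set
InWindow ℓ i t j = ∃[ s ] (s < t) × ((toℕ j ≡ toℕ i + s) ⊎ (toℕ j + ℓ ≡ toℕ i + s))

{-# OPTIONS --safe #-}
module Submission where

-- Suppose v ∉ C is adjacent to c(x) and c(x+s), to none of the vertices strictly between, and
-- 2 ≤ s ≤ ℓ − 3. Then v, c(x), …, c(x+s) is a hole of length s + 2 < ℓ, against the minimality
-- of C. So if c(x) is a neighbour of v and c(x+1) is not (an exit), none of the next ℓ − 3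
-- vertices is a neighbour: all neighbours lie among c(x−2), c(x−1), c(x), and with ℓ ≥ 5 the
-- same argument shows that c(x−2) adjacent forces c(x−1) adjacent. An exit exists unless v is
-- adjacent to every vertex of C.

open import Defs
open import Data.Nat using (ℕ; zero; suc; _+_; _*_; _∸_; _≤_; _<_; z≤n; s≤s; s≤s⁻¹; _≟_; _<?_; _≤?_; NonZero; >-nonZero)
open import Data.Nat.Properties
open import Data.Nat.DivMod using (_mod_; _%_; m%n<n; m<n⇒m%n≡m; m≤n⇒[n∸m]%m≡n%m; %-distribˡ-+)
open import Data.Fin using (Fin; toℕ; zero; suc)
import Data.Fin.Properties as FP
open import Data.Product using (_×_; _,_; proj₁; proj₂; uncurry; ∃-syntax; Σ-syntax)
open import Data.Sum using (_⊎_; inj₁; inj₂)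
import Data.Sum as Sum
open import Data.Sum.Function.Propositional using (_⊎-⇔_)
open import Data.Empty using (⊥-elim)
open import Function.Base using (_∘_)
open import Function.Bundles using (_⇔_; mk⇔; Equivalence)
open import Function.Definitions using (Injective)
open import Function.Construct.Symmetry using (⇔-sym)
open import Function.Construct.Composition using (_⇔-∘_)
open import Function.Related.Propositional using (module EquationalReasoning)
open import Relation.Nullary using (¬_; yes; no)
open import Relation.Nullary.Decidable using (decidable-stable)
open import Relation.Unary using (Decidable)
open import Relation.Binary.PropositionalEquality

exit-point : {P : ℕ → Set} → Decidable P → ∀ m {a} → P a → ¬ P (m + a) → ∃[ x ] P x × ¬ P (suc x)
exit-point P? zero Pa ¬Pa = ⊥-elim (¬Pa Pa)
exit-point {P} P? (suc m) {a} Pa ¬P[1+m+a] with P? (suc a)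
... | no ¬P[1+a] = a , Pa , ¬P[1+a]
... | yes P[1+a] = exit-point P? m P[1+a] (¬P[1+m+a] ∘ subst P (+-suc m a))

Succ-suc⇔ : ∀ {m} {a b : Fin m} → Succ (suc m) (suc a) (suc b) ⇔ suc (toℕ a) ≡ toℕ b
Succ-suc⇔ = mk⇔ (λ { (inj₁ e) → suc-injective e ; (inj₂ (_ , ())) }) (inj₁ ∘ cong suc)

CycAdj-sym : ∀ {m i j} → CycAdj m i j ⇔ CycAdj m j i
CycAdj-sym = mk⇔ Sum.swap Sum.swap

CycAdj-zero-suc⇔ : ∀ {m} {b : Fin (suc m)} → CycAdj (2 + m) zero (suc b) ⇔ (toℕ b ≡ 0 ⊎ toℕ b ≡ m)
CycAdj-zero-suc⇔ = mk⇔
  (λ { (inj₁ (inj₁ e)) → inj₁ (sym (suc-injective e))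
     ; (inj₁ (inj₂ (() , _)))
     ; (inj₂ (inj₁ ()))
     ; (inj₂ (inj₂ (e , _))) → inj₂ (suc-injective (suc-injective e)) })
  (λ { (inj₁ e) → inj₁ (inj₁ (cong suc (sym e))) ; (inj₂ e) → inj₂ (inj₂ (cong (λ m → suc (suc m)) e , refl)) })


module Cyclic (ℓ : ℕ) .{{_ : NonZero ℓ}} where

  pos : ℕ → Fin ℓ
  pos x = x mod ℓ

  -- j lies a steps after i (for a < ℓ), in the shape of the body of InWindow.
  Offset : Fin ℓ → ℕ → Fin ℓ → Set
  Offset i a j = (toℕ j ≡ toℕ i + a) ⊎ (toℕ j + ℓ ≡ toℕ i + a)

  private
    wrapped-≮ℓ : ∀ m {n} → m + ℓ ≡ n → ¬ n < ℓ
    wrapped-≮ℓ m refl = m+n≮n m ℓ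

    reduce-once : ∀ m → m < ℓ + ℓ → (m % ℓ ≡ m) ⊎ (m % ℓ + ℓ ≡ m)
    reduce-once m m<2ℓ with m <? ℓ
    ... | yes m<ℓ = inj₁ (m<n⇒m%n≡m m<ℓ)
    ... | no m≮ℓ = inj₂ (begin
      m % ℓ + ℓ         ≡⟨ cong (_+ ℓ) (m≤n⇒[n∸m]%m≡n%m ℓ≤m) ⟨
      (m ∸ ℓ) % ℓ + ℓ   ≡⟨ cong (_+ ℓ) (m<n⇒m%n≡m (m<n+o⇒m∸n<o m ℓ m<2ℓ)) ⟩
      m ∸ ℓ + ℓ         ≡⟨ m∸n+n≡m ℓ≤m ⟩
      m                 ∎)
      where
        open ≡-Reasoning
        ℓ≤m : ℓ ≤ m
        ℓ≤m = ≮⇒≥ m≮ℓ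

  toℕ-pos : ∀ x → toℕ (pos x) ≡ x % ℓ
  toℕ-pos x = FP.toℕ-fromℕ< (m%n<n x ℓ)

  toℕ-pos-+ : ∀ x {a} → a < ℓ → toℕ (pos (a + x)) ≡ (x % ℓ + a) % ℓ
  toℕ-pos-+ x {a} a<ℓ = begin
    toℕ (pos (a + x))        ≡⟨ toℕ-pos (a + x) ⟩
    (a + x) % ℓ              ≡⟨ cong (_% ℓ) (+-comm a x) ⟩
    (x + a) % ℓ              ≡⟨ %-distribˡ-+ x a ℓ ⟩
    (x % ℓ + a % ℓ) % ℓ      ≡⟨ cong (λ r → (x % ℓ + r) % ℓ) (m<n⇒m%n≡m a<ℓ) ⟩
    (x % ℓ + a) % ℓ          ∎
    where open ≡-Reasoning

  offset-pos : ∀ x {a} → a < ℓ → Offset (pos x) a (pos (a + x))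
  offset-pos x {a} a<ℓ =
    subst₂ (λ p q → (p ≡ q + a) ⊎ (p + ℓ ≡ q + a)) (sym (toℕ-pos-+ x a<ℓ)) (sym (toℕ-pos x))
      (reduce-once (x % ℓ + a) (+-mono-< (m%n<n x ℓ) a<ℓ))

  offset-unique : ∀ {i a j j′} → Offset i a j → Offset i a j′ → j ≡ j′
  offset-unique (inj₁ p) (inj₁ q) = FP.toℕ-injective (trans p (sym q))
  offset-unique (inj₂ p) (inj₂ q) = FP.toℕ-injective (+-cancelʳ-≡ ℓ _ _ (trans p (sym q)))
  offset-unique {j = j} (inj₁ p) (inj₂ q) = ⊥-elim (wrapped-≮ℓ _ (trans q (sym p)) (FP.toℕ<n j))
  offset-unique {j′ = j′} (inj₂ p) (inj₁ q) = ⊥-elim (wrapped-≮ℓ _ (trans p (sym q)) (FP.toℕ<n j′))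

  offset-injective : ∀ {i a b j} → a < ℓ → b < ℓ → Offset i a j → Offset i b j → a ≡ b
  offset-injective {i} _ _ (inj₁ p) (inj₁ q) = +-cancelˡ-≡ (toℕ i) _ _ (trans (sym p) q)
  offset-injective {i} _ _ (inj₂ p) (inj₂ q) = +-cancelˡ-≡ (toℕ i) _ _ (trans (sym p) q)
  offset-injective {i} {a} {b} {j} _ b<ℓ (inj₁ p) (inj₂ q) = ⊥-elim (wrapped-≮ℓ a a+ℓ≡b b<ℓ)
    where
      open ≡-Reasoning
      a+ℓ≡b : a + ℓ ≡ b
      a+ℓ≡b = +-cancelˡ-≡ (toℕ i) _ _ (begin
        toℕ i + (a + ℓ)  ≡⟨ +-assoc (toℕ i) a ℓ ⟨
        toℕ i + a + ℓ    ≡⟨ cong (_+ ℓ) p ⟨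
        toℕ j + ℓ        ≡⟨ q ⟩
        toℕ i + b        ∎)
  offset-injective a<ℓ b<ℓ (inj₂ p) (inj₁ q) = sym (offset-injective b<ℓ a<ℓ (inj₁ q) (inj₂ p))

  offset-reach : ∀ i j → ∃[ a ] a < ℓ × Offset i a j
  offset-reach i j with toℕ i ≤? toℕ j
  ... | yes i≤j = toℕ j ∸ toℕ i , ≤-<-trans (m∸n≤m (toℕ j) (toℕ i)) (FP.toℕ<n j) , inj₁ (sym (m+[n∸m]≡n i≤j))
  ... | no i≰j = toℕ j + ℓ ∸ toℕ i , a<ℓ , inj₂ (sym (m+[n∸m]≡n i≤j+ℓ))
    where
      a<ℓ : toℕ j + ℓ ∸ toℕ i < ℓ
      a<ℓ = m<n+o⇒m∸n<o (toℕ j + ℓ) (toℕ i) (+-monoˡ-< ℓ (≰⇒> i≰j))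
      i≤j+ℓ : toℕ i ≤ toℕ j + ℓ
      i≤j+ℓ = ≤-trans (<⇒≤ (FP.toℕ<n i)) (m≤n+m ℓ (toℕ j))

  pos-offset⇔ : ∀ x {a} j → a < ℓ → Offset (pos x) a j ⇔ pos (a + x) ≡ j
  pos-offset⇔ x {a} j a<ℓ = mk⇔ (offset-unique {pos x} {a} (offset-pos x a<ℓ)) (λ { refl → offset-pos x a<ℓ })

  pos-reach : ∀ x j → ∃[ a ] a < ℓ × pos (a + x) ≡ j
  pos-reach x j with offset-reach (pos x) j
  ... | a , a<ℓ , off = a , a<ℓ , Equivalence.to (pos-offset⇔ x j a<ℓ) off

  pos-+-injective : ∀ {x a b} → a < ℓ → b < ℓ → pos (a + x) ≡ pos (b + x) → a ≡ b
  pos-+-injective {x} a<ℓ b<ℓ eq =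
    offset-injective {pos x} a<ℓ b<ℓ (offset-pos x a<ℓ) (subst (Offset (pos x) _) (sym eq) (offset-pos x b<ℓ))

  Succ⇔Offset1 : ∀ {i j} → Succ ℓ i j ⇔ Offset i 1 j
  Succ⇔Offset1 {i} {j} = mk⇔ to from
    where
      1+i≡i+1 : suc (toℕ i) ≡ toℕ i + 1
      1+i≡i+1 = +-comm 1 (toℕ i)
      to : Succ ℓ i j → Offset i 1 j
      to (inj₁ p) = inj₁ (trans (sym p) 1+i≡i+1)
      to (inj₂ (p , q)) = inj₂ (trans (cong (_+ ℓ) q) (trans (sym p) 1+i≡i+1))
      from : Offset i 1 j → Succ ℓ i j
      from (inj₁ p) = inj₁ (trans 1+i≡i+1 (sym p))
      from (inj₂ p) = inj₂ (trans (sym p′) (cong (_+ ℓ) j≡0) , j≡0)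
        where
          p′ : toℕ j + ℓ ≡ suc (toℕ i)
          p′ = trans p (sym 1+i≡i+1)
          j≡0 : toℕ j ≡ 0
          j≡0 = n≤0⇒n≡0 (+-cancelʳ-≤ ℓ (toℕ j) 0 (subst (_≤ ℓ) (sym p′) (FP.toℕ<n i)))

  Succ-pos⇔ : ∀ {x a b} → suc a < ℓ → b < ℓ → Succ ℓ (pos (a + x)) (pos (b + x)) ⇔ suc a ≡ b
  Succ-pos⇔ {x} {a} {b} 1+a<ℓ b<ℓ = begin
    Succ ℓ (pos (a + x)) (pos (b + x))     ∼⟨ Succ⇔Offset1 ⟩
    Offset (pos (a + x)) 1 (pos (b + x))   ∼⟨ pos-offset⇔ (a + x) (pos (b + x)) (≤-<-trans (s≤s z≤n) 1+a<ℓ) ⟩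
    pos (suc a + x) ≡ pos (b + x)          ∼⟨ mk⇔ (pos-+-injective 1+a<ℓ b<ℓ) (cong (λ m → pos (m + x))) ⟩
    suc a ≡ b                              ∎
    where open EquationalReasoning

  InWindow-pos⇔ : ∀ {w t} j → t ≤ ℓ → InWindow ℓ (pos w) t j ⇔ (∃[ u ] u < t × pos (u + w) ≡ j)
  InWindow-pos⇔ {w} j t≤ℓ = mk⇔
    (λ (u , u<t , off) → u , u<t , Equivalence.to (pos-offset⇔ w j (<-≤-trans u<t t≤ℓ)) off)
    (λ (u , u<t , eq) → u , u<t , Equivalence.from (pos-offset⇔ w j (<-≤-trans u<t t≤ℓ)) eq)

  ⇔InWindow : ∀ {Q : Fin ℓ → Set} b k t → k + t ≤ ℓ →
           (∀ s → s < ℓ → Q (pos (s + b)) → s < k + t) →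
           (∀ s → s < k → ¬ Q (pos (s + b))) →
           (∀ u → u < t → Q (pos (u + (k + b)))) →
           ∀ j → Q j ⇔ InWindow ℓ (pos (k + b)) t j
  ⇔InWindow {Q} b k t k+t≤ℓ ends-before skips covers j =
    ⇔-sym (InWindow-pos⇔ j (≤-trans (m≤n+m t k) k+t≤ℓ)) ⇔-∘ mk⇔ (into j) out-of
    where
      into : ∀ j → Q j → ∃[ u ] u < t × pos (u + (k + b)) ≡ j
      into j Qj with pos-reach b j
      ... | s , s<ℓ , refl with m≤n⇒∃[o]m+o≡n (≮⇒≥ (λ s<k → skips s s<k Qj))
      ...   | u , refl = u , +-cancelˡ-< k u t (ends-before (k + u) s<ℓ Qj) , cong pos shift
        where
          shift : u + (k + b) ≡ k + u + b
          shift = trans (sym (+-assoc u k b)) (cong (_+ b) (+-comm u k))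
      out-of : ∃[ u ] u < t × pos (u + (k + b)) ≡ j → Q j
      out-of (u , u<t , refl) = covers u u<t


module Neighbours (G : Graph) {ℓ : ℕ} .{{_ : NonZero ℓ}} (c : Fin ℓ → Fin (n G)) (v : Fin (n G)) where
  open Cyclic ℓ

  Adjacent : Fin ℓ → Set
  Adjacent j = _~_ G v (c j)

  Adjacent? : Decidable Adjacent
  Adjacent? j = ~-dec G v (c j)

  -- Positions on C are naturals read modulo ℓ and written offset first, t + x, so that
  -- suc (t + x) is suc t + x by computation.
  Adj : ℕ → Set
  Adj x = Adjacent (pos x)

  Adj? : Decidable Adj
  Adj? x = Adjacent? (pos x)

  Gap : ℕ → ℕ → Set
  Gap x s = ∀ t → 1 ≤ t → t < s → ¬ Adj (t + x)

  Exit : ℕ → Set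
  Exit x = Adj x × ¬ Adj (suc x)

  exit-exists : ∀ {i j} → Adjacent i → ¬ Adjacent j → ∃[ b ] Exit (2 + b)
  exit-exists {i} {j} v∼ci v≁cj =
    let a , _ , a+2↦i = pos-reach 2 i
        m , _ , m+a+2↦j = pos-reach (a + 2) j
        y , exit = exit-point (λ z → Adj? (z + 2)) m
                     (subst Adjacent (sym a+2↦i) v∼ci)
                     (v≁cj ∘ subst Adjacent (trans (cong pos (+-assoc m a 2)) m+a+2↦j))
    in y , subst Exit (+-comm y 2) exit

  gap-hole : IsHole G ℓ c → ¬ InCycle G c v → ∀ {x s} → 2 ≤ s → 2 + s ≤ ℓ →
             Adj x → Adj (s + x) → Gap x s → Σ[ d ∈ (Fin (2 + s) → Fin (n G)) ] IsHole G (2 + s) d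
  gap-hole (_ , c-injective , c-adjacency) v∉C {x} {s} 2≤s 2+s≤ℓ ax asx gap =
    d , s≤s (s≤s 2≤s) , d-injective , d-adjacency
    where
      open EquationalReasoning

      d : Fin (2 + s) → Fin (n G)
      d zero = v
      d (suc i) = c (pos (toℕ i + x))

      1+i<ℓ : (i : Fin (suc s)) → suc (toℕ i) < ℓ
      1+i<ℓ i = ≤-trans (s≤s (FP.toℕ<n i)) 2+s≤ℓ

      i<ℓ : (i : Fin (suc s)) → toℕ i < ℓ
      i<ℓ i = <-trans (n<1+n _) (1+i<ℓ i)

      d-injective : Injective _≡_ _≡_ d
      d-injective {zero} {zero} _ = refl
      d-injective {zero} {suc j} v≡cj = ⊥-elim (v∉C (_ , sym v≡cj))
      d-injective {suc i} {zero} ci≡v = ⊥-elim (v∉C (_ , ci≡v))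
      d-injective {suc i} {suc j} ci≡cj =
        cong suc (FP.toℕ-injective (pos-+-injective (i<ℓ i) (i<ℓ j) (c-injective ci≡cj)))

      Adj-on-path⇔ : (i : Fin (suc s)) → Adj (toℕ i + x) ⇔ (toℕ i ≡ 0 ⊎ toℕ i ≡ s)
      Adj-on-path⇔ i = mk⇔ to from
        where
          to : Adj (toℕ i + x) → toℕ i ≡ 0 ⊎ toℕ i ≡ s
          to a with toℕ i ≟ 0 | toℕ i ≟ s
          ... | yes i≡0 | _       = inj₁ i≡0
          ... | no _    | yes i≡s = inj₂ i≡s
          ... | no i≢0  | no i≢s  = ⊥-elim (gap (toℕ i) (n≢0⇒n>0 i≢0) (≤∧≢⇒< (s≤s⁻¹ (FP.toℕ<n i)) i≢s) a)
          from : toℕ i ≡ 0 ⊎ toℕ i ≡ s → Adj (toℕ i + x)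
          from (inj₁ i≡0) = subst (λ t → Adj (t + x)) (sym i≡0) ax
          from (inj₂ i≡s) = subst (λ t → Adj (t + x)) (sym i≡s) asx

      d-adjacency : ∀ i j → _~_ G (d i) (d j) ⇔ CycAdj (2 + s) i j
      d-adjacency zero zero = mk⇔ (⊥-elim ∘ ~-irrefl G)
        (λ { (inj₁ (inj₁ ())) ; (inj₁ (inj₂ (() , _))) ; (inj₂ (inj₁ ())) ; (inj₂ (inj₂ (() , _))) })
      d-adjacency zero (suc j) = begin
        Adj (toℕ j + x)                 ∼⟨ Adj-on-path⇔ j ⟩
        (toℕ j ≡ 0 ⊎ toℕ j ≡ s)         ∼⟨ ⇔-sym CycAdj-zero-suc⇔ ⟩
        CycAdj (2 + s) zero (suc j)     ∎
      d-adjacency (suc i) zero = begin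
        _~_ G (d (suc i)) v             ∼⟨ mk⇔ (~-sym G) (~-sym G) ⟩
        _~_ G v (d (suc i))             ∼⟨ d-adjacency zero (suc i) ⟩
        CycAdj (2 + s) zero (suc i)     ∼⟨ CycAdj-sym ⟩
        CycAdj (2 + s) (suc i) zero     ∎
      d-adjacency (suc i) (suc j) = begin
        _~_ G (d (suc i)) (d (suc j))                     ∼⟨ c-adjacency _ _ ⟩
        CycAdj ℓ (pos (toℕ i + x)) (pos (toℕ j + x))      ∼⟨ Succ-pos⇔ (1+i<ℓ i) (i<ℓ j) ⊎-⇔ Succ-pos⇔ (1+i<ℓ j) (i<ℓ i) ⟩
        ((suc (toℕ i) ≡ toℕ j) ⊎ (suc (toℕ j) ≡ toℕ i))   ∼⟨ ⇔-sym (Succ-suc⇔ ⊎-⇔ Succ-suc⇔) ⟩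
        CycAdj (2 + s) (suc i) (suc j)                    ∎

  ConsecutiveNeighbours≤3 : Set
  ConsecutiveNeighbours≤3 = ∃[ i ] ∃[ t ] (1 ≤ t) × (t ≤ 3) × (∀ j → Adjacent j ⇔ InWindow ℓ i t j)

  module _ (shortest : IsShortestHole G ℓ c) (v∉C : ¬ InCycle G c v) (5≤ℓ : 5 ≤ ℓ) where

    no-neighbours-after-exit : ∀ {x} → Exit x → ∀ t → 1 ≤ t → 3 + t ≤ ℓ → ¬ Adj (t + x)
    no-neighbours-after-exit {x} (ax , ¬a[1+x]) t 1≤t 3+t≤ℓ = gap-upto (suc t) 3+t≤ℓ t 1≤t ≤-refl
      where
        gap-closes : ∀ s → 1 ≤ s → 3 + s ≤ ℓ → Gap x s → ¬ Adj (s + x)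
        gap-closes 1 _ _ _ = ¬a[1+x]
        gap-closes s@(suc (suc _)) _ 3+s≤ℓ gap asx =
          let d , hole = gap-hole (proj₁ shortest) v∉C (s≤s (s≤s z≤n)) (<⇒≤ 3+s≤ℓ) ax asx gap
          in <-irrefl refl (≤-trans 3+s≤ℓ (proj₂ shortest (2 + s) d hole))

        gap-upto : ∀ s → 2 + s ≤ ℓ → Gap x s
        gap-upto (suc s) 3+s≤ℓ t 1≤t t<1+s with m≤n⇒m<n∨m≡n (s≤s⁻¹ t<1+s)
        ... | inj₁ t<s = gap-upto s (<⇒≤ 3+s≤ℓ) t 1≤t t<s
        ... | inj₂ refl = gap-closes t 1≤t 3+s≤ℓ (gap-upto t (<⇒≤ 3+s≤ℓ))

    no-gap-of-one : ∀ {y} → Adj y → Adj (2 + y) → Adj (1 + y)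
    no-gap-of-one ay a[2+y] =
      decidable-stable (Adj? _) λ ¬a[1+y] → no-neighbours-after-exit (ay , ¬a[1+y]) 2 (s≤s z≤n) 5≤ℓ a[2+y]

    neighbours-before-exit : ∀ {b} → Exit (2 + b) → ∀ s → s < ℓ → Adj (s + b) → s < 3
    neighbours-before-exit _ 0 _ _ = s≤s z≤n
    neighbours-before-exit _ 1 _ _ = s≤s (s≤s z≤n)
    neighbours-before-exit _ 2 _ _ = ≤-refl
    neighbours-before-exit {b} exit (suc (suc (suc t))) 4+t≤ℓ a[3+t+b] =
      ⊥-elim (no-neighbours-after-exit exit (suc t) (s≤s z≤n) 4+t≤ℓ (subst Adj shift a[3+t+b]))
      where
        shift : 3 + t + b ≡ suc t + (2 + b)
        shift = trans (cong (λ m → suc m + b) (+-comm 2 t)) (+-assoc (suc t) 2 b)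

    private
      3≤ℓ : 3 ≤ ℓ
      3≤ℓ = ≤-trans (m≤m+n 3 2) 5≤ℓ

    window-before-exit : ∀ b → Exit (2 + b) → ConsecutiveNeighbours≤3
    window-before-exit b exit@(a[2+b] , _) with Adj? b | Adj? (1 + b)
    ... | yes a[b] | _ = pos b , 3 , s≤s z≤n , ≤-refl ,
      ⇔InWindow b 0 3 3≤ℓ (neighbours-before-exit exit) (λ _ ())
        λ { 0 _ → a[b] ; 1 _ → no-gap-of-one a[b] a[2+b] ; 2 _ → a[2+b] ; (suc (suc (suc _))) (s≤s (s≤s (s≤s ()))) }
    ... | no ¬a[b] | yes a[1+b] = pos (1 + b) , 2 , s≤s z≤n , s≤s (s≤s z≤n) ,
      ⇔InWindow b 1 2 3≤ℓ (neighbours-before-exit exit) (λ { 0 _ → ¬a[b] ; (suc _) (s≤s ()) })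
        λ { 0 _ → a[1+b] ; 1 _ → a[2+b] ; (suc (suc _)) (s≤s (s≤s ())) }
    ... | no ¬a[b] | no ¬a[1+b] = pos (2 + b) , 1 , s≤s z≤n , s≤s z≤n ,
      ⇔InWindow b 2 1 3≤ℓ (neighbours-before-exit exit) (λ { 0 _ → ¬a[b] ; 1 _ → ¬a[1+b] ; (suc (suc _)) (s≤s (s≤s ())) })
        λ { 0 _ → a[2+b] ; (suc _) (s≤s ()) }

    window-or-complete : ∀ {i} → Adjacent i → ConsecutiveNeighbours≤3 ⊎ (∀ j → Adjacent j)
    window-or-complete v∼ci with FP.all? Adjacent?
    ... | yes complete = inj₂ complete
    ... | no ¬complete =
      inj₁ (uncurry window-before-exit (exit-exists v∼ci (proj₂ (FP.¬∀⟶∃¬ ℓ Adjacent Adjacent? ¬complete))))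


lemma4p1 : (G : Graph) (k : ℕ) → 1 ≤ k →
    (ℓ : ℕ) (c : Fin ℓ → Fin (n G)) →
    IsShortestHole G ℓ c → MuLt k ℓ → ChordalMinus G c →
    (v : Fin (n G)) → InNbhd G c v →
    (∃[ i ] ∃[ t ] (1 ≤ t) × (t ≤ 3) × (∀ j → (_~_ G v (c j)) ⇔ InWindow ℓ i t j))
    ⊎ (∀ j → _~_ G v (c j))
lemma4p1 G k _ ℓ c shortest@((4≤ℓ , _) , _) μk<ℓ _ v (v∉C , _ , v∼ci) =
  Neighbours.window-or-complete G c v shortest v∉C 5≤ℓ v∼ci
  where
    5≤ℓ : 5 ≤ ℓ
    5≤ℓ = begin
      5                               ≤⟨ m≤n+m 5 1980 ⟩
      1985                            ≤⟨ m≤n+m 1985 (3217 * k) ⟩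
      3217 * k + 1985                 ≤⟨ m≤m+n _ (1216 * suc k) ⟩
      3217 * k + 1985 + 1216 * suc k  ≤⟨ proj₁ μk<ℓ ⟩
      ℓ                               ∎
      where open ≤-Reasoning

    -- Taken from 4 ≤ ℓ: derived from 5≤ℓ, instance resolution would normalise the
    -- unary arithmetic on 1985 above.
    instance
      ℓ-nonZero : NonZero ℓ
      ℓ-nonZero = >-nonZero (≤-trans (s≤s z≤n) 4≤ℓ)
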